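{- Let $T$ be a tree with $\operatorname{diam}(T)\geq 6$ and let $T\overline{T}$ be its complementary prism. Then for any pair of adjacent vertices $u,v$ of $T$, $V(\overline{T})\subseteq [\{\overline{u},\overline{v}\}]_{T\overline{T}}$, where $\overline{u},\overline{v}$ are the copies of $u,v$ in $\overline{T}$.
   Context: For a graph $G$ with complement $\overline{G}$, the complementary prism $G\overline{G}$ is the graph obtained from the disjoint union of $G$ and $\overline{G}$ by adding the perfect matching joining each vertex $v$ of $G$ to its copy $\overline{v}$ in $\overline{G}$. For a graph $H$, a set $S\subseteq V(H)$ is (geodesically) convex if every vertex on every shortest path between two vertices of $S$ belongs to $S$; the convex hull $[S]_H$ is the smallest convex set of $H$ containing $S$. -}

module Defs where

open import Level using (0ℓ)
import Level
open import Data.Nat using (ℕ; zero; suc; _≤_)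
open import Data.Fin using (Fin)
open import Data.Sum using (_⊎_; inj₁; inj₂)
open import Data.Product using (_×_; _,_; ∃; ∃-syntax; Σ-syntax)
open import Data.Empty using (⊥)
open import Data.List using (List; []; _∷_)
open import Data.List.Relation.Unary.Unique.Propositional using (Unique)
open import Relation.Nullary using (¬_)
open import Relation.Unary using (Pred; _⊆_; _∈_)
open import Relation.Binary.PropositionalEquality using (_≡_; _≢_; refl; sym)

record Graph (V : Set) : Set₁ where
  field
    Adj    : V → V → Set
    adj-sym    : ∀ {u v} → Adj u v → Adj v u
    adj-irrefl : ∀ {v} → ¬ Adj v v
open Graph public

module _ {V : Set} (G : Graph V) where

  data Walk : V → V → ℕ → Set where
    here : ∀ v → Walk v v 0
    step : ∀ {u w v k} → Adj G u w → Walk w v k → Walk u v (suc k)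

  verts : ∀ {u v k} → Walk u v k → List V
  verts (here v) = v ∷ []
  verts (step {u = u} _ w) = u ∷ verts w

  OnWalk : ∀ {u v k} → Walk u v k → V → Set
  OnWalk (here v) x = x ≡ v
  OnWalk (step {u = u} _ w) x = x ≡ u ⊎ OnWalk w x

  Connected : Set
  Connected = ∀ u v → ∃[ k ] Walk u v k

  -- a cycle x y ... x of length k+1 ≥ 3 whose vertices y,...,x are distinct
  HasCycle : Set
  HasCycle = ∃[ x ] ∃[ y ] ∃[ k ] Σ[ e ∈ Adj G x y ] Σ[ w ∈ Walk y x k ]
               (2 ≤ k × Unique (verts w))

  IsTree : Set
  IsTree = Connected × ¬ HasCycle

  Dist : V → V → ℕ → Set
  Dist u v d = Walk u v d × (∀ k → Walk u v k → d ≤ k)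

  DiamAtLeast : ℕ → Set
  DiamAtLeast m = ∃[ u ] ∃[ v ] ∃[ d ] (Dist u v d × m ≤ d)

  IsGeodesic : ∀ {u v k} → Walk u v k → Set
  IsGeodesic {u} {v} {k} _ = ∀ k' → Walk u v k' → k ≤ k'

  Convex : Pred V 0ℓ → Set
  Convex S = ∀ {u v k} → u ∈ S → v ∈ S → (w : Walk u v k) → IsGeodesic w →
             ∀ x → OnWalk w x → x ∈ S

  Hull : Pred V 0ℓ → Pred V (Level.suc 0ℓ)
  Hull S x = (C : Pred V 0ℓ) → S ⊆ C → Convex C → x ∈ C

complement : ∀ {V} → Graph V → Graph V
complement G = record
  { Adj = λ u v → u ≢ v × ¬ Adj G u v
  ; adj-sym = λ { (ne , na) → (λ e → ne (sym e)) , (λ a → na (Graph.adj-sym G a)) }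
  ; adj-irrefl = λ { (ne , _) → ne refl } }

-- complementary prism G Ḡ on V ⊎ V: inj₁ v is v ∈ G, inj₂ v is v̄ ∈ Ḡ
prismAdj : ∀ {V} → Graph V → V ⊎ V → V ⊎ V → Set
prismAdj G (inj₁ u) (inj₁ v) = Adj G u v
prismAdj G (inj₂ u) (inj₂ v) = Adj (complement G) u v
prismAdj G (inj₁ u) (inj₂ v) = u ≡ v
prismAdj G (inj₂ u) (inj₁ v) = u ≡ v

prism : ∀ {V} → Graph V → Graph (V ⊎ V)
prism G = record { Adj = prismAdj G ; adj-sym = λ {a} {b} → s {a} {b} ; adj-irrefl = λ {a} → i {a} }
  where
  s : ∀ {a b} → prismAdj G a b → prismAdj G b a
  s {inj₁ u} {inj₁ v} e = Graph.adj-sym G e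
  s {inj₂ u} {inj₂ v} e = Graph.adj-sym (complement G) e
  s {inj₁ u} {inj₂ v} e = sym e
  s {inj₂ u} {inj₁ v} e = sym e
  i : ∀ {a} → ¬ prismAdj G a a
  i {inj₁ u} = Graph.adj-irrefl G
  i {inj₂ u} = Graph.adj-irrefl (complement G)

pair : ∀ {A : Set} → A → A → Pred A 0ℓ
pair a b x = x ≡ a ⊎ x ≡ b

-- Call x far from an edge ab when x is neither equal nor adjacent to a or b. A vertex x far
-- from an edge ab of T is a common neighbour of ā and b̄ in T̄, while ā and b̄ are at distance 2
-- in the prism; hence ā x̄ b̄ is a geodesic and every convex set containing ā and b̄ contains x̄.
-- Take a geodesic s p … q t of length ≥ 6. Since s and t are far apart, every vertex is far
-- from sp or from qt, the vertices s, p are far from qt and q, t far from sp, and an arbitrary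
-- edge uv is far from one of the two end edges. So a convex set containing ū, v̄ captures one
-- end edge, then the other, and then all of V(T̄). Acyclicity only serves to decide adjacency.
module Submission where

open import Defs
open import Level using (0ℓ)
open import Data.Nat using (ℕ; zero; suc; _≤_; _+_; z≤n; s≤s; _≤?_)
open import Data.Nat.Properties using (+-mono-≤; ≤-trans; n≤1+n; ≤⇒≯)
open import Data.Fin using (Fin; _≟_)
open import Data.Sum using (_⊎_; inj₁; inj₂)
open import Data.Product using (_×_; _,_; ∃-syntax; Σ-syntax; proj₁; proj₂)
open import Data.Empty using (⊥; ⊥-elim)
open import Data.List using ([]; _∷_)
import Data.List.Relation.Unary.All as All
open import Data.List.Relation.Unary.Any using (Any; here; there; any?)
open import Data.List.Relation.Unary.All.Properties using (¬Any⇒All¬)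
open import Data.List.Relation.Unary.AllPairs using ([]; _∷_)
open import Data.List.Relation.Unary.Unique.Propositional using (Unique)
open import Relation.Nullary using (¬_; Dec; yes; no)
open import Relation.Nullary.Decidable using (True; toWitness; _⊎-dec_)
open import Relation.Unary using (Pred; _∈_)
open import Relation.Binary.Definitions using (Decidable; DecidableEquality)
open import Relation.Binary.PropositionalEquality using (_≡_; _≢_; refl; sym)

module Walks {V : Set} (G : Graph V) where

  _++ʷ_ : ∀ {a b c k l} → Walk G a b k → Walk G b c l → Walk G a c (k + l)
  here _   ++ʷ q = q
  step e p ++ʷ q = step e (p ++ʷ q)

  Within : V → V → ℕ → Set
  Within a b m = ∃[ k ] (Walk G a b k × k ≤ m)

  infixr 5 _++ᵂ_
  _++ᵂ_ : ∀ {a b c m l} → Within a b m → Within b c l → Within a c (m + l)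
  (k , p , k≤m) ++ᵂ (k′ , q , k′≤l) = k + k′ , p ++ʷ q , +-mono-≤ k≤m k′≤l

  within-weaken : ∀ {a b m l} → m ≤ l → Within a b m → Within a b l
  within-weaken m≤l (k , p , k≤m) = k , p , ≤-trans k≤m m≤l

  within-refl : ∀ {a} → Within a a 0
  within-refl {a} = 0 , here a , z≤n

  within-edge : ∀ {a b} → Adj G a b → Within a b 1
  within-edge {b = b} e = 1 , step e (here b) , s≤s z≤n

  dist-lower : ∀ {a b d m} → Dist G a b d → Within a b m → d ≤ m
  dist-lower (_ , minimal) (k , p , k≤m) = ≤-trans (minimal k p) k≤m

  walk-ends : ∀ {a b k} → Walk G a b k → 1 ≤ k → (∃[ p ] Adj G a p) × (∃[ q ] Adj G q b)
  walk-ends (step e (here _))   _ = (_ , e) , (_ , e)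
  walk-ends (step e (step f w)) _ = (_ , e) , proj₂ (walk-ends (step f w) (s≤s z≤n))

  NearVertex : V → V → Set
  NearVertex x a = x ≡ a ⊎ Adj G x a

  NearEdge : V → V → V → Set
  NearEdge x a b = NearVertex x a ⊎ NearVertex x b

  nearVertex⇒within : ∀ {x a} → NearVertex x a → Within x a 1
  nearVertex⇒within (inj₁ refl) = within-weaken z≤n within-refl
  nearVertex⇒within (inj₂ e)    = within-edge e

  nearVertex⇒within˘ : ∀ {x a} → NearVertex x a → Within a x 1
  nearVertex⇒within˘ (inj₁ refl) = within-weaken z≤n within-refl
  nearVertex⇒within˘ (inj₂ e)    = within-edge (adj-sym G e)

  nearEdge⇒within-from : ∀ {x a b} → Adj G a b → NearEdge x a b → Within a x 2
  nearEdge⇒within-from e (inj₁ xa) = within-weaken (n≤1+n 1) (nearVertex⇒within˘ xa)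
  nearEdge⇒within-from e (inj₂ xb) = within-edge e ++ᵂ nearVertex⇒within˘ xb

  nearEdge⇒within-to : ∀ {x a b} → Adj G a b → NearEdge x a b → Within x b 2
  nearEdge⇒within-to e (inj₁ xa) = nearVertex⇒within xa ++ᵂ within-edge e
  nearEdge⇒within-to e (inj₂ xb) = within-weaken (n≤1+n 1) (nearVertex⇒within xb)

  nearEdge⇒within : ∀ {x y a b} → Adj G a b → NearEdge x a b → NearEdge y a b → Within x y 3
  nearEdge⇒within e (inj₁ xa) (inj₁ ya) =
    within-weaken (n≤1+n 2) (nearVertex⇒within xa ++ᵂ nearVertex⇒within˘ ya)
  nearEdge⇒within e (inj₁ xa) (inj₂ yb) =
    nearVertex⇒within xa ++ᵂ within-edge e ++ᵂ nearVertex⇒within˘ yb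
  nearEdge⇒within e (inj₂ xb) (inj₁ ya) =
    nearVertex⇒within xb ++ᵂ within-edge (adj-sym G e) ++ᵂ nearVertex⇒within˘ ya
  nearEdge⇒within e (inj₂ xb) (inj₂ yb) =
    within-weaken (n≤1+n 2) (nearVertex⇒within xb ++ᵂ nearVertex⇒within˘ yb)

  nearEdge? : DecidableEquality V → Decidable (Adj G) → ∀ x a b → Dec (NearEdge x a b)
  nearEdge? _≟_ adj? x a b = ((x ≟ a) ⊎-dec adj? x a) ⊎-dec ((x ≟ b) ⊎-dec adj? x b)

  common-neighbour∈convex : ∀ {C a b x} → Convex G C → a ∈ C → b ∈ C →
    a ≢ b → ¬ Adj G a b → Adj G a x → Adj G x b → x ∈ C
  common-neighbour∈convex {a = a} {b} {x} convex a∈C b∈C a≢b ¬ab ax xb =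
    convex a∈C b∈C (step ax (step xb (here b))) geodesic x (inj₂ (inj₁ refl))
    where
    geodesic : ∀ k → Walk G a b k → 2 ≤ k
    geodesic zero          (here _)          = ⊥-elim (a≢b refl)
    geodesic (suc zero)    (step e (here _)) = ⊥-elim (¬ab e)
    geodesic (suc (suc k)) _                 = s≤s (s≤s z≤n)

  Path : V → V → Set
  Path a b = Σ[ k ∈ ℕ ] Σ[ p ∈ Walk G a b k ] Unique (verts G p)

  suffix-path : ∀ {u y v k} (p : Walk G y v k) →
                Any (u ≡_) (verts G p) → Unique (verts G p) → Path u v
  suffix-path (here v)   (here refl) uniq         = 0 , here v , uniq
  suffix-path (step e p) (here refl) uniq         = _ , step e p , uniq
  suffix-path (step e p) (there u∈p) (_ ∷ uniq)   = suffix-path p u∈p uniq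

  walk⇒path : DecidableEquality V → ∀ {a b k} → Walk G a b k → Path a b
  walk⇒path _≟_ (here v) = 0 , here v , All.[] ∷ []
  walk⇒path _≟_ (step {u = u} e w) with walk⇒path _≟_ w
  ... | k , p , uniq with any? (u ≟_) (verts G p)
  ...   | yes u∈p = suffix-path p u∈p uniq
  ...   | no  u∉p = suc k , step e p , ¬Any⇒All¬ _ u∉p ∷ uniq

  -- A path a … b of length ≥ 2 closes up with an edge ba to a cycle.
  tree-adj? : DecidableEquality V → IsTree G → Decidable (Adj G)
  tree-adj? _≟_ (connected , acyclic) a b with walk⇒path _≟_ (proj₂ (connected a b))
  ... | 0 , here _ , _                 = no (adj-irrefl G)
  ... | 1 , step e (here _) , _        = yes e
  ... | suc (suc k) , p , uniq         =
        no λ e → acyclic (b , a , suc (suc k) , adj-sym G e , p , s≤s (s≤s z≤n) , uniq)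

module _ {V : Set} (T : Graph V) where

  open Walks T

  far∈convex : ∀ {C a b x} → Convex (prism T) C → Adj T a b →
               C (inj₂ a) → C (inj₂ b) → ¬ NearEdge x a b → C (inj₂ x)
  far∈convex convex ab ā∈C b̄∈C far =
    Walks.common-neighbour∈convex (prism T) convex ā∈C b̄∈C
      (λ { refl → adj-irrefl T ab })
      (λ (_ , ¬ab) → ¬ab ab)
      ((λ a≡x → far (inj₁ (inj₁ (sym a≡x)))) , (λ ax → far (inj₁ (inj₂ (adj-sym T ax)))))
      ((λ x≡b → far (inj₂ (inj₁ x≡b)))       , (λ xb → far (inj₂ (inj₂ xb))))

module EndEdges {V : Set} (T : Graph V) (_≟_ : DecidableEquality V) (adj? : Decidable (Adj T))
  {s p q t : V} (sp : Adj T s p) (qt : Adj T q t) (far : ∀ {m} → Walks.Within T s t m → 6 ≤ m)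
  (C : Pred (V ⊎ V) 0ℓ) (convex : Convex (prism T) C) where

  open Walks T

  Captured : V → V → Set
  Captured a b = C (inj₂ a) × C (inj₂ b)

  spread : ∀ {a b} → Adj T a b → Captured a b → ∀ x → ¬ NearEdge x a b → C (inj₂ x)
  spread ab (ā∈C , b̄∈C) x = far∈convex T convex ab ā∈C b̄∈C

  close⊥ : ∀ {m} → Within s t m → {True (m ≤? 5)} → ⊥
  close⊥ w {m≤5} = ≤⇒≯ (toWitness m≤5) (far w)

  first⇒last : Captured s p → Captured q t
  first⇒last c =
      spread sp c q (λ n → close⊥ (nearEdge⇒within-from sp n ++ᵂ within-edge qt))
    , spread sp c t (λ n → close⊥ (nearEdge⇒within-from sp n))

  last⇒first : Captured q t → Captured s p
  last⇒first c =
      spread qt c s (λ n → close⊥ (nearEdge⇒within-to qt n))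
    , spread qt c p (λ n → close⊥ (within-edge sp ++ᵂ nearEdge⇒within-to qt n))

  ends⇒all : Captured s p → Captured q t → ∀ x → C (inj₂ x)
  ends⇒all first last x with nearEdge? _≟_ adj? x s p
  ... | no  xs = spread sp first x xs
  ... | yes xs = spread qt last x λ xq →
        close⊥ (nearEdge⇒within-from sp xs ++ᵂ nearEdge⇒within-to qt xq)

  last-from-near : ∀ {u v y} → Adj T u v → Captured u v →
                   Within s y 1 → NearEdge y u v → Captured q t
  last-from-near uv c sy yu =
      spread uv c q (λ qu → close⊥ (sy ++ᵂ nearEdge⇒within uv yu qu ++ᵂ within-edge qt))
    , spread uv c t (λ tu → close⊥ (sy ++ᵂ nearEdge⇒within uv yu tu))

  some-end : ∀ {u v} → Adj T u v → Captured u v → Captured s p ⊎ Captured q t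
  some-end {u} {v} uv c with nearEdge? _≟_ adj? s u v | nearEdge? _≟_ adj? p u v
  ... | yes su | _      = inj₂ (last-from-near uv c (within-weaken z≤n within-refl) su)
  ... | no _   | yes pu = inj₂ (last-from-near uv c (within-edge sp) pu)
  ... | no su  | no pu  = inj₁ (spread uv c s su , spread uv c p pu)

  edge⇒all : ∀ {u v} → Adj T u v → Captured u v → ∀ x → C (inj₂ x)
  edge⇒all uv c with some-end uv c
  ... | inj₁ first = ends⇒all first (first⇒last first)
  ... | inj₂ last  = ends⇒all (last⇒first last) last

lemma3p3 : (n : ℕ) (T : Graph (Fin n)) → IsTree T → DiamAtLeast T 6 →
    ∀ u v → Adj T u v →
    ∀ x → Hull (prism T) (pair (inj₂ u) (inj₂ v)) (inj₂ x)
lemma3p3 n T tree (s , t , d , dist , 6≤d) u v uv x C pair⊆C convex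
  with Walks.walk-ends T (proj₁ dist) (≤-trans (s≤s z≤n) 6≤d)
... | (_ , sp) , (_ , qt) =
  EndEdges.edge⇒all T _≟_ (Walks.tree-adj? T _≟_ tree) sp qt far C convex
    uv (pair⊆C (inj₁ refl) , pair⊆C (inj₂ refl)) x
  where
  far : ∀ {m} → Walks.Within T s t m → 6 ≤ m
  far w = ≤-trans 6≤d (Walks.dist-lower T dist w)
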